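{- Let $n,p$ be positive integers, $k=2^p$, $q$ a prime, $G = (\mathbb{Z}/q\mathbb{Z})^n$, and let $P$ be a subspace of $G$. Then for every $B \subseteq P$, $$T_k(B) \ge \Big( \frac{|B|}{|P|} \Big)^{2k} T_k(P),$$ i.e. $P$ is connected of degree $k$ with constant $C=1$.
   Context: For a finite set $A$ in an Abelian group and integer $k\ge2$, $T_k(A)$ is the number of $2k$-tuples $(a_1,\dots,a_k,a'_1,\dots,a'_k)\in A^{2k}$ with $a_1+\dots+a_k=a'_1+\dots+a'_k$. A finite nonempty set $A$ is connected of degree $k$ with constant $C\in(0,1]$ if $T_k(B)\ge C^{2k}(|B|/|A|)^{2k}T_k(A)$ for every $B\subseteq A$. -}

module Defs where

open import Data.Nat using (ℕ; zero; suc; _+_; _*_; NonZero)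
open import Data.Nat.DivMod using (_mod_)
open import Data.Fin using (Fin; toℕ)
import Data.Fin.Properties as FinP
open import Data.Vec using (Vec; []; _∷_; zipWith; replicate; foldr)
import Data.Vec.Properties as VecP
open import Data.List using (List; []; _∷_; [_]; map; concatMap; cartesianProduct; filter; length)
open import Data.List.Membership.Propositional using (_∈_)
open import Data.List.Relation.Unary.Unique.Propositional using (Unique)
open import Data.Product using (_×_; proj₁; proj₂)
open import Relation.Binary.PropositionalEquality using (_≡_)
open import Relation.Nullary using (Dec)

module _ (q : ℕ) .{{_ : NonZero q}} where

  _+q_ : Fin q → Fin q → Fin q
  a +q b = (toℕ a + toℕ b) mod q

  _*q_ : Fin q → Fin q → Fin q
  a *q b = (toℕ a * toℕ b) mod q

  0q : Fin q
  0q = 0 mod q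

  G : ℕ → Set
  G n = Vec (Fin q) n

  vadd : ∀ {n} → G n → G n → G n
  vadd = zipWith _+q_

  vzero : ∀ {n} → G n
  vzero = replicate _ 0q

  smul : ∀ {n} → Fin q → G n → G n
  smul c = Data.Vec.map (c *q_)

  _≟G_ : ∀ {n} (x y : G n) → Dec (x ≡ y)
  _≟G_ = VecP.≡-dec FinP._≟_

  tsum : ∀ {n k} → Vec (G n) k → G n
  tsum = foldr _ vadd vzero

  tuples : ∀ {n} → List (G n) → (k : ℕ) → List (Vec (G n) k)
  tuples A zero    = [ [] ]
  tuples A (suc k) = concatMap (λ a → map (a ∷_) (tuples A k)) A

  T : ∀ {n} → ℕ → List (G n) → ℕ
  T k A = length (filter (λ pr → tsum (proj₁ pr) ≟G tsum (proj₂ pr))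
                         (cartesianProduct (tuples A k) (tuples A k)))

  -- A finite set, represented as a duplicate-free list.
  -- P is a subspace (over the field ℤ/qℤ) of G.
  record IsSubspace {n : ℕ} (P : List (G n)) : Set where
    field
      unique   : Unique P
      zero∈    : vzero ∈ P
      add-closed  : ∀ {x y} → x ∈ P → y ∈ P → vadd x y ∈ P
      smul-closed : ∀ c {x} → x ∈ P → smul c x ∈ P

{-# OPTIONS --safe #-}
module Submission where

-- For k ≥ 1 a solution of a₁ + … + a_k = a′₁ + … + a′_k in P is determined by
-- all entries but a′_k, because translation in G is injective; hence
-- T_k(P) ≤ |P|^(2k−1). On the other side let r(x) count the k-tuples of B with
-- sum x. These sums all lie in P, so ∑_{x∈P} r(x) = |B|^k and
-- T_k(B) = ∑_{x∈P} r(x)², and Cauchy–Schwarz gives |B|^(2k) ≤ |P| T_k(B).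

open import Defs
open import Data.Nat using (ℕ; zero; suc; _+_; _*_; _∸_; _^_; _≤_; z≤n; NonZero)
open import Data.Nat.Properties
open import Data.Nat.DivMod using (_%_; %-distribˡ-+; m%n%n≡m%n; [m+n]%n≡m%n; m<n⇒m%n≡m)
open import Data.Nat.Tactic.RingSolver using (solve-∀)
open import Data.Nat.Primality using (Prime)
open import Data.Fin using (Fin; toℕ)
import Data.Fin.Properties as FinP
open import Data.Vec using ([]; _∷_)
import Data.Vec.Properties as VecP
open import Data.List using (List; []; _∷_; length; map; _++_; concatMap; filter; cartesianProduct)
open import Data.List.Membership.Propositional using (_∈_)
open import Data.List.Relation.Unary.Any using (here; there)
open import Data.List.Relation.Unary.All as All using (All; []; _∷_)
import Data.List.Relation.Unary.All.Properties as AllP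
open import Data.List.Relation.Unary.AllPairs using ([]; _∷_)
open import Data.List.Relation.Unary.Unique.Propositional using (Unique)
open import Data.Product using (_,_; proj₁; proj₂)
open import Data.Sum using ([_,_]′)
open import Data.Empty using (⊥-elim)
open import Function using (_∘_)
open import Function.Definitions using (Injective)
open import Relation.Binary.Definitions using (DecidableEquality)
open import Relation.Binary.PropositionalEquality
open import Relation.Nullary using (Dec; yes; no)
open import Relation.Unary using (Decidable)

𝟙 : ∀ {p} {P : Set p} → Dec P → ℕ
𝟙 (yes _) = 1
𝟙 (no _)  = 0

∑ : ∀ {a} {A : Set a} → List A → (A → ℕ) → ℕ
∑ []       f = 0
∑ (x ∷ xs) f = f x + ∑ xs f

infix 8 ∑
syntax ∑ xs (λ x → e) = ∑[ x ← xs ] e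

module _ {a} {A : Set a} where

  ∑-++ : ∀ xs ys (f : A → ℕ) → ∑[ x ← xs ++ ys ] f x ≡ ∑[ x ← xs ] f x + ∑[ x ← ys ] f x
  ∑-++ []       ys f = refl
  ∑-++ (x ∷ xs) ys f = trans (cong (f x +_) (∑-++ xs ys f)) (sym (+-assoc (f x) _ _))

  ∑-cong : ∀ xs {f g : A → ℕ} → (∀ x → f x ≡ g x) → ∑[ x ← xs ] f x ≡ ∑[ x ← xs ] g x
  ∑-cong []       f≡g = refl
  ∑-cong (x ∷ xs) f≡g = cong₂ _+_ (f≡g x) (∑-cong xs f≡g)

  ∑-mono-≤ : ∀ xs {f g : A → ℕ} → (∀ x → f x ≤ g x) → ∑[ x ← xs ] f x ≤ ∑[ x ← xs ] g x
  ∑-mono-≤ []       f≤g = z≤n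
  ∑-mono-≤ (x ∷ xs) f≤g = +-mono-≤ (f≤g x) (∑-mono-≤ xs f≤g)

  ∑-+ : ∀ xs (f g : A → ℕ) → ∑[ x ← xs ] (f x + g x) ≡ ∑[ x ← xs ] f x + ∑[ x ← xs ] g x
  ∑-+ []       f g = refl
  ∑-+ (x ∷ xs) f g = trans (cong (f x + g x +_) (∑-+ xs f g)) (interchange (f x) (g x) _ _)
    where
    interchange : ∀ a b c d → a + b + (c + d) ≡ a + c + (b + d)
    interchange = solve-∀

  ∑-*ʳ : ∀ xs (f : A → ℕ) c → ∑[ x ← xs ] (f x * c) ≡ ∑[ x ← xs ] f x * c
  ∑-*ʳ []       f c = refl
  ∑-*ʳ (x ∷ xs) f c = trans (cong (f x * c +_) (∑-*ʳ xs f c)) (sym (*-distribʳ-+ c (f x) _))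

  ∑-*ˡ : ∀ xs (f : A → ℕ) c → ∑[ x ← xs ] (c * f x) ≡ c * ∑[ x ← xs ] f x
  ∑-*ˡ xs f c = trans (∑-cong xs (λ x → *-comm c (f x))) (trans (∑-*ʳ xs f c) (*-comm _ c))

  ∑-const : ∀ (xs : List A) c → ∑[ _ ← xs ] c ≡ length xs * c
  ∑-const []       c = refl
  ∑-const (x ∷ xs) c = cong (c +_) (∑-const xs c)

  ∑-1 : ∀ (xs : List A) → ∑[ _ ← xs ] 1 ≡ length xs
  ∑-1 xs = trans (∑-const xs 1) (*-identityʳ _)

  ∑-zero : ∀ {xs} {f : A → ℕ} → All (λ x → f x ≡ 0) xs → ∑[ x ← xs ] f x ≡ 0
  ∑-zero []           = refl
  ∑-zero (fx≡0 ∷ fxs≡0) = cong₂ _+_ fx≡0 (∑-zero fxs≡0)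

  length-filter≡∑𝟙 : ∀ {p} {P : A → Set p} (P? : Decidable P) xs →
                     length (filter P? xs) ≡ ∑[ x ← xs ] 𝟙 (P? x)
  length-filter≡∑𝟙 P? []       = refl
  length-filter≡∑𝟙 P? (x ∷ xs) with P? x
  ... | yes _ = cong suc (length-filter≡∑𝟙 P? xs)
  ... | no _  = length-filter≡∑𝟙 P? xs

module _ {a b} {A : Set a} {B : Set b} where

  ∑-map : ∀ (g : A → B) xs (f : B → ℕ) → ∑[ y ← map g xs ] f y ≡ ∑[ x ← xs ] f (g x)
  ∑-map g []       f = refl
  ∑-map g (x ∷ xs) f = cong (f (g x) +_) (∑-map g xs f)

module _ {a b} {A : Set a} {B : Set b} where

  ∑-concatMap : ∀ (g : A → List B) xs (f : B → ℕ) →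
                ∑[ y ← concatMap g xs ] f y ≡ ∑[ x ← xs ] ∑[ y ← g x ] f y
  ∑-concatMap g []       f = refl
  ∑-concatMap g (x ∷ xs) f = trans (∑-++ (g x) _ f) (cong (∑ (g x) f +_) (∑-concatMap g xs f))

  ∑-cartesianProduct : ∀ xs ys (f : A → B → ℕ) →
    ∑[ xy ← cartesianProduct xs ys ] f (proj₁ xy) (proj₂ xy) ≡ ∑[ x ← xs ] ∑[ y ← ys ] f x y
  ∑-cartesianProduct []       ys f = refl
  ∑-cartesianProduct (x ∷ xs) ys f = trans (∑-++ (map (x ,_) ys) _ _)
    (cong₂ _+_ (∑-map (x ,_) ys _) (∑-cartesianProduct xs ys f))

  ∑-comm : ∀ xs ys (f : A → B → ℕ) → ∑[ x ← xs ] ∑[ y ← ys ] f x y ≡ ∑[ y ← ys ] ∑[ x ← xs ] f x y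
  ∑-comm []       ys f = sym (trans (∑-const ys 0) (*-zeroʳ (length ys)))
  ∑-comm (x ∷ xs) ys f = trans (cong (∑ ys (f x) +_) (∑-comm xs ys f)) (sym (∑-+ ys (f x) _))

  ∑*∑≡∑∑ : ∀ xs ys (f : A → ℕ) (g : B → ℕ) →
           ∑[ x ← xs ] f x * ∑[ y ← ys ] g y ≡ ∑[ x ← xs ] ∑[ y ← ys ] (f x * g y)
  ∑*∑≡∑∑ xs ys f g = trans (sym (∑-*ʳ xs f _)) (∑-cong xs (λ x → sym (∑-*ˡ ys g (f x))))

m*n+m*n≤m*m+n*n : ∀ m n → m * n + m * n ≤ m * m + n * n
m*n+m*n≤m*m+n*n m n = [ ordered , swapped ]′ (≤-total m n)
  where
  ordered : ∀ {m n} → m ≤ n → m * n + m * n ≤ m * m + n * n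
  ordered {m} m≤n with m≤n⇒∃[o]m+o≡n m≤n
  ... | d , refl = subst (m * (m + d) + m * (m + d) ≤_) (gap m d) (m≤m+n _ (d * d))
    where
    gap : ∀ m d → m * (m + d) + m * (m + d) + d * d ≡ m * m + (m + d) * (m + d)
    gap = solve-∀

  swapped : n ≤ m → m * n + m * n ≤ m * m + n * n
  swapped n≤m = subst₂ _≤_ (cong₂ _+_ (*-comm n m) (*-comm n m)) (+-comm (n * n) (m * m)) (ordered n≤m)

m+m≤n+n⇒m≤n : ∀ {m n} → m + m ≤ n + n → m ≤ n
m+m≤n+n⇒m≤n m+m≤n+n = ≮⇒≥ (λ n<m → <⇒≱ (+-mono-< n<m n<m) m+m≤n+n)

module _ {a} {A : Set a} where

  cauchy-schwarz : ∀ xs (c : A → ℕ) →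
                   ∑[ x ← xs ] c x * ∑[ x ← xs ] c x ≤ length xs * ∑[ x ← xs ] (c x * c x)
  cauchy-schwarz xs c = m+m≤n+n⇒m≤n (begin
      S * S + S * S
        ≡⟨ cong₂ _+_ (∑*∑≡∑∑ xs xs c c) (∑*∑≡∑∑ xs xs c c) ⟩
      ∑[ x ← xs ] ∑[ y ← xs ] (c x * c y) + ∑[ x ← xs ] ∑[ y ← xs ] (c x * c y)
        ≡⟨ ∑-+ xs _ _ ⟨
      ∑[ x ← xs ] (∑[ y ← xs ] (c x * c y) + ∑[ y ← xs ] (c x * c y))
        ≡⟨ ∑-cong xs (λ x → ∑-+ xs _ _) ⟨
      ∑[ x ← xs ] ∑[ y ← xs ] (c x * c y + c x * c y)
        ≤⟨ ∑-mono-≤ xs (λ x → ∑-mono-≤ xs (λ y → m*n+m*n≤m*m+n*n (c x) (c y))) ⟩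
      ∑[ x ← xs ] ∑[ y ← xs ] (c x * c x + c y * c y)
        ≡⟨ ∑-cong xs (λ x → trans (∑-+ xs _ _) (cong (_+ Q) (∑-const xs _))) ⟩
      ∑[ x ← xs ] (length xs * (c x * c x) + Q)
        ≡⟨ ∑-+ xs _ _ ⟩
      ∑[ x ← xs ] (length xs * (c x * c x)) + ∑[ _ ← xs ] Q
        ≡⟨ cong₂ _+_ (∑-*ˡ xs _ (length xs)) (∑-const xs Q) ⟩
      length xs * Q + length xs * Q ∎)
    where
    open ≤-Reasoning
    S = ∑[ x ← xs ] c x
    Q = ∑[ x ← xs ] (c x * c x)

module _ {a} {A : Set a} (_≟_ : DecidableEquality A) where

  fibreSize : ∀ {b} {B : Set b} → List B → (B → A) → A → ℕ
  fibreSize ys g x = ∑[ y ← ys ] 𝟙 (x ≟ g y)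

  ∑-𝟙≢ : ∀ {xs y} (f : A → ℕ) → All (_≢ y) xs → ∑[ x ← xs ] (𝟙 (x ≟ y) * f x) ≡ 0
  ∑-𝟙≢ {y = y} f = ∑-zero ∘ All.map vanish
    where
    vanish : ∀ {x} → x ≢ y → 𝟙 (x ≟ y) * f x ≡ 0
    vanish {x} x≢y with x ≟ y
    ... | yes x≡y = ⊥-elim (x≢y x≡y)
    ... | no _    = refl

  ∑-𝟙≡ : ∀ {xs y} (f : A → ℕ) → Unique xs → y ∈ xs → ∑[ x ← xs ] (𝟙 (x ≟ y) * f x) ≡ f y
  ∑-𝟙≡ {x ∷ _} f (x∉xs ∷ _) (here refl) with x ≟ x
  ... | yes _   = trans (cong (f x + 0 +_) (∑-𝟙≢ f (All.map ≢-sym x∉xs)))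
                        (trans (+-identityʳ _) (+-identityʳ _))
  ... | no x≢x = ⊥-elim (x≢x refl)
  ∑-𝟙≡ {x ∷ _} {y} f (x∉xs ∷ xs-unique) (there y∈xs) with x ≟ y
  ... | yes refl = ⊥-elim (All.lookup x∉xs y∈xs refl)
  ... | no _     = ∑-𝟙≡ f xs-unique y∈xs

  ∑-fibres : ∀ {b} {B : Set b} {xs} ys (g : B → A) (f : A → ℕ) →
             Unique xs → All (λ y → g y ∈ xs) ys →
             ∑[ y ← ys ] f (g y) ≡ ∑[ x ← xs ] (fibreSize ys g x * f x)
  ∑-fibres {xs = xs} [] g f _ [] = sym (∑-zero (All.tabulate {xs = xs} (λ _ → refl)))
  ∑-fibres {xs = xs} (y ∷ ys) g f xs-unique (gy∈xs ∷ gys∈xs) = begin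
      f (g y) + ∑[ y ← ys ] f (g y)
        ≡⟨ cong₂ _+_ (sym (∑-𝟙≡ f xs-unique gy∈xs)) (∑-fibres ys g f xs-unique gys∈xs) ⟩
      ∑[ x ← xs ] (𝟙 (x ≟ g y) * f x) + ∑[ x ← xs ] (fibreSize ys g x * f x)
        ≡⟨ ∑-+ xs _ _ ⟨
      ∑[ x ← xs ] (𝟙 (x ≟ g y) * f x + fibreSize ys g x * f x)
        ≡⟨ ∑-cong xs (λ x → *-distribʳ-+ (f x) (𝟙 (x ≟ g y)) _) ⟨
      ∑[ x ← xs ] (fibreSize (y ∷ ys) g x * f x) ∎
    where open ≡-Reasoning

  fibreSize≤1 : ∀ {b} {B : Set b} {g : B → A} {xs} →
                Injective _≡_ _≡_ g → Unique xs → ∀ x → fibreSize xs g x ≤ 1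
  fibreSize≤1 {xs = []}         g-inj []                   x = z≤n
  fibreSize≤1 {g = g} {y ∷ ys} g-inj (y∉ys ∷ ys-unique) x with x ≟ g y
  ... | yes refl = ≤-reflexive (cong suc (∑-zero (All.map miss y∉ys)))
    where
    miss : ∀ {z} → y ≢ z → 𝟙 (g y ≟ g z) ≡ 0
    miss {z} y≢z with g y ≟ g z
    ... | yes gy≡gz = ⊥-elim (y≢z (g-inj gy≡gz))
    ... | no _      = refl
  ... | no _     = fibreSize≤1 g-inj ys-unique x

m^[2*k]≡m^k*m^k : ∀ m k → m ^ (2 * k) ≡ m ^ k * m ^ k
m^[2*k]≡m^k*m^k m k = trans (cong (m ^_) (cong (k +_) (+-identityʳ k))) (^-distribˡ-+-* m k k)

module _ (q : ℕ) .{{_ : NonZero q}} where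

  [a+qt+[q∸t]]%q≡a : ∀ (a t : Fin q) → (toℕ (_+q_ q a t) + (q ∸ toℕ t)) % q ≡ toℕ a
  [a+qt+[q∸t]]%q≡a a t = begin
      (toℕ (_+q_ q a t) + (q ∸ toℕ t)) % q
        ≡⟨ cong (λ z → (z + (q ∸ toℕ t)) % q) (FinP.toℕ-fromℕ< _) ⟩
      ((toℕ a + toℕ t) % q + (q ∸ toℕ t)) % q
        ≡⟨ %-distribˡ-+ ((toℕ a + toℕ t) % q) _ q ⟩
      ((toℕ a + toℕ t) % q % q + (q ∸ toℕ t) % q) % q
        ≡⟨ cong (λ z → (z + (q ∸ toℕ t) % q) % q) (m%n%n≡m%n (toℕ a + toℕ t) q) ⟩
      ((toℕ a + toℕ t) % q + (q ∸ toℕ t) % q) % q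
        ≡⟨ %-distribˡ-+ (toℕ a + toℕ t) _ q ⟨
      (toℕ a + toℕ t + (q ∸ toℕ t)) % q
        ≡⟨ cong (_% q) (trans (+-assoc (toℕ a) _ _) (cong (toℕ a +_) (m+[n∸m]≡n (<⇒≤ (FinP.toℕ<n t))))) ⟩
      (toℕ a + q) % q
        ≡⟨ [m+n]%n≡m%n (toℕ a) q ⟩
      toℕ a % q
        ≡⟨ m<n⇒m%n≡m (FinP.toℕ<n a) ⟩
      toℕ a ∎
    where open ≡-Reasoning

  +q-cancelʳ : ∀ t → Injective _≡_ _≡_ (λ a → _+q_ q a t)
  +q-cancelʳ t {a} {a′} a+t≡a′+t = FinP.toℕ-injective (begin
      toℕ a                                  ≡⟨ [a+qt+[q∸t]]%q≡a a t ⟨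
      (toℕ (_+q_ q a t) + (q ∸ toℕ t)) % q   ≡⟨ cong (λ z → (toℕ z + (q ∸ toℕ t)) % q) a+t≡a′+t ⟩
      (toℕ (_+q_ q a′ t) + (q ∸ toℕ t)) % q  ≡⟨ [a+qt+[q∸t]]%q≡a a′ t ⟩
      toℕ a′                                 ∎)
    where open ≡-Reasoning

  vadd-cancelʳ : ∀ {n} (t : G q n) → Injective _≡_ _≡_ (λ a → vadd q a t)
  vadd-cancelʳ []      {[]}    {[]}      _ = refl
  vadd-cancelʳ (s ∷ t) {x ∷ a} {x′ ∷ a′} e =
    cong₂ _∷_ (+q-cancelʳ s (VecP.∷-injectiveˡ e)) (vadd-cancelʳ t (VecP.∷-injectiveʳ e))

  sumCount : ∀ {n} → ℕ → List (G q n) → G q n → ℕ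
  sumCount k A = fibreSize (_≟G_ q) (tuples q A k) (tsum q)

  length-tuples : ∀ {n} (A : List (G q n)) k → length (tuples q A k) ≡ length A ^ k
  length-tuples A zero    = refl
  length-tuples A (suc k) = begin
      length (tuples q A (suc k))
        ≡⟨ ∑-1 (tuples q A (suc k)) ⟨
      ∑[ _ ← tuples q A (suc k) ] 1
        ≡⟨ ∑-concatMap (λ a → map (a ∷_) (tuples q A k)) A _ ⟩
      ∑[ a ← A ] ∑[ _ ← map (a ∷_) (tuples q A k) ] 1
        ≡⟨ ∑-cong A (λ a → trans (∑-map (a ∷_) (tuples q A k) _) (trans (∑-1 (tuples q A k)) (length-tuples A k))) ⟩
      ∑[ _ ← A ] length A ^ k
        ≡⟨ ∑-const A _ ⟩
      length A * length A ^ k ∎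
    where open ≡-Reasoning

  T≡∑sumCount : ∀ {n} k (A : List (G q n)) → T q k A ≡ ∑[ u ← tuples q A k ] sumCount k A (tsum q u)
  T≡∑sumCount k A = trans (length-filter≡∑𝟙 _ (cartesianProduct L L)) (∑-cartesianProduct L L _)
    where L = tuples q A k

  sumCount-suc≤ : ∀ {n} {A : List (G q n)} → Unique A → ∀ m s → sumCount (suc m) A s ≤ length A ^ m
  sumCount-suc≤ {A = A} A-unique m s = begin
      sumCount (suc m) A s
        ≡⟨ ∑-concatMap (λ a → map (a ∷_) R) A _ ⟩
      ∑[ a ← A ] ∑[ v ← map (a ∷_) R ] 𝟙 (_≟G_ q s (tsum q v))
        ≡⟨ ∑-cong A (λ a → ∑-map (a ∷_) R _) ⟩
      ∑[ a ← A ] ∑[ u ← R ] 𝟙 (_≟G_ q s (vadd q a (tsum q u)))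
        ≡⟨ ∑-comm A R _ ⟩
      ∑[ u ← R ] fibreSize (_≟G_ q) A (λ a → vadd q a (tsum q u)) s
        ≤⟨ ∑-mono-≤ R (λ u → fibreSize≤1 (_≟G_ q) (vadd-cancelʳ (tsum q u)) A-unique s) ⟩
      ∑[ _ ← R ] 1
        ≡⟨ trans (∑-1 R) (length-tuples A m) ⟩
      length A ^ m ∎
    where
    open ≤-Reasoning
    R = tuples q A m

  T-suc-upper-bound : ∀ {n} {A : List (G q n)} → Unique A → ∀ m →
                      T q (suc m) A ≤ length A ^ suc m * length A ^ m
  T-suc-upper-bound {A = A} A-unique m = begin
      T q (suc m) A
        ≡⟨ T≡∑sumCount (suc m) A ⟩
      ∑[ u ← L ] sumCount (suc m) A (tsum q u)
        ≤⟨ ∑-mono-≤ L (λ u → sumCount-suc≤ A-unique m (tsum q u)) ⟩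
      ∑[ _ ← L ] length A ^ m
        ≡⟨ trans (∑-const L _) (cong (_* length A ^ m) (length-tuples A (suc m))) ⟩
      length A ^ suc m * length A ^ m ∎
    where
    open ≤-Reasoning
    L = tuples q A (suc m)

  module _ {n} {P : List (G q n)} (0∈P : vzero q ∈ P)
           (+-closed : ∀ {x y} → x ∈ P → y ∈ P → vadd q x y ∈ P) where

    tuples-tsum∈ : ∀ {B} → All (_∈ P) B → ∀ k → All (λ u → tsum q u ∈ P) (tuples q B k)
    tuples-tsum∈ B⊆P zero    = 0∈P ∷ []
    tuples-tsum∈ B⊆P (suc k) =
      AllP.concat⁺ (AllP.map⁺ (All.map (λ a∈P → AllP.map⁺ (All.map (+-closed a∈P) (tuples-tsum∈ B⊆P k))) B⊆P))

  T-lower-bound : ∀ {n} {P B : List (G q n)} k → Unique P → All (λ u → tsum q u ∈ P) (tuples q B k) →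
                  length B ^ k * length B ^ k ≤ length P * T q k B
  T-lower-bound {P = P} {B} k P-unique sums∈P = begin
      length B ^ k * length B ^ k
        ≡⟨ cong (λ z → z * z) ∑r≡|B|^k ⟨
      ∑[ x ← P ] r x * ∑[ x ← P ] r x
        ≤⟨ cauchy-schwarz P r ⟩
      length P * ∑[ x ← P ] (r x * r x)
        ≡⟨ cong (length P *_) T≡∑r² ⟨
      length P * T q k B ∎
    where
    open ≤-Reasoning
    L = tuples q B k
    r = sumCount k B
    T≡∑r² : T q k B ≡ ∑[ x ← P ] (r x * r x)
    T≡∑r² = trans (T≡∑sumCount k B) (∑-fibres (_≟G_ q) L (tsum q) r P-unique sums∈P)
    ∑r≡|B|^k : ∑[ x ← P ] r x ≡ length B ^ k
    ∑r≡|B|^k = begin-equality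
      ∑[ x ← P ] r x              ≡⟨ ∑-cong P (λ x → *-identityʳ (r x)) ⟨
      ∑[ x ← P ] (r x * 1)        ≡⟨ ∑-fibres (_≟G_ q) L (tsum q) (λ _ → 1) P-unique sums∈P ⟨
      ∑[ _ ← L ] 1                ≡⟨ ∑-1 L ⟩
      length L                    ≡⟨ length-tuples B k ⟩
      length B ^ k                ∎

  subgroup-connected : ∀ {n} {P B : List (G q n)} → Unique P → vzero q ∈ P →
                       (∀ {x y} → x ∈ P → y ∈ P → vadd q x y ∈ P) → All (_∈ P) B →
                       ∀ k .{{_ : NonZero k}} →
                       length B ^ (2 * k) * T q k P ≤ T q k B * length P ^ (2 * k)
  subgroup-connected {P = P} {B} P-unique 0∈P +-closed B⊆P k@(suc m) = begin
      length B ^ (2 * k) * T q k P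
        ≡⟨ cong (_* T q k P) (m^[2*k]≡m^k*m^k (length B) k) ⟩
      length B ^ k * length B ^ k * T q k P
        ≤⟨ *-monoʳ-≤ (length B ^ k * length B ^ k) (T-suc-upper-bound P-unique m) ⟩
      length B ^ k * length B ^ k * (length P ^ k * length P ^ m)
        ≤⟨ *-monoˡ-≤ (length P ^ k * length P ^ m) (T-lower-bound {B = B} k P-unique (tuples-tsum∈ 0∈P +-closed B⊆P k)) ⟩
      length P * T q k B * (length P ^ k * length P ^ m)
        ≡⟨ rearrange (length P) (T q k B) (length P ^ k) (length P ^ m) ⟩
      T q k B * (length P ^ k * length P ^ k)
        ≡⟨ cong (T q k B *_) (m^[2*k]≡m^k*m^k (length P) k) ⟨
      T q k B * length P ^ (2 * k) ∎
    where
    open ≤-Reasoning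
    rearrange : ∀ p t a b → p * t * (a * b) ≡ t * (a * (p * b))
    rearrange = solve-∀

corollary2p4 : (n p : ℕ) → 1 ≤ n → 1 ≤ p →
  (q : ℕ) .{{_ : NonZero q}} → Prime q →
  (P : List (G q n)) → IsSubspace q P →
  (B : List (G q n)) → Unique B → (∀ {x} → x ∈ B → x ∈ P) →
  length B ^ (2 * (2 ^ p)) * T q (2 ^ p) P ≤ T q (2 ^ p) B * length P ^ (2 * (2 ^ p))
corollary2p4 _ p _ _ q _ P P-subspace B _ B⊆P =
  subgroup-connected q unique zero∈ add-closed (All.tabulate B⊆P) (2 ^ p) {{m^n≢0 2 p}}
  where open IsSubspace P-subspace
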